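{- If $p$ is an odd prime and $a$ is a positive integer, then $g\big(\frac{p^a+1}{2},p^{2a}\big)=2$.
   Context: For a prime power $q$ and a positive integer $k\mid q-1$, the Waring number $g(k,q)$ is the least positive integer $s$ such that every element of $\mathbb{F}_q$ can be written as $x_1^k+\cdots+x_s^k$ with $x_i\in\mathbb{F}_q$ (if such $s$ exists). -}

module Defs where

open import Level using (Level; _⊔_; suc)
open import Data.Nat using (ℕ; _≤_; _<_)
open import Data.Fin using (Fin)
open import Data.Product using (Σ; ∃; _×_)
open import Relation.Nullary using (¬_)
open import Relation.Binary.PropositionalEquality as ≡ using (_≡_)
open import Algebra.Bundles using (CommutativeRing; Semiring)
open import Function.Bundles using (Inverse)
import Algebra.Definitions.RawSemiring as RS

record Field (c ℓ : Level) : Set (Level.suc (c ⊔ ℓ)) where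
  field
    commutativeRing : CommutativeRing c ℓ
  open CommutativeRing commutativeRing public
  field
    0≉1     : ¬ (0# ≈ 1#)
    inverse : ∀ x → ¬ (x ≈ 0#) → Σ Carrier λ y → (x * y) ≈ 1#

record FiniteField (c ℓ : Level) (q : ℕ) : Set (Level.suc (c ⊔ ℓ)) where
  field
    fld : Field c ℓ
  open Field fld public
  field
    card : Inverse setoid (≡.setoid (Fin q))

module _ {c ℓ : Level} {q : ℕ} (F : FiniteField c ℓ q) where
  open FiniteField F
  open RS (Semiring.rawSemiring semiring) using (_^_; sum)

  AllSumsOfPowers : ℕ → ℕ → Set (c ⊔ ℓ)
  AllSumsOfPowers k s = ∀ (y : Carrier) → Σ (Fin s → Carrier) λ x → sum (λ i → x i ^ k) ≈ y

  IsWaringNumber : ℕ → ℕ → Set (c ⊔ ℓ)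
  IsWaringNumber k s = (1 ≤ s) × AllSumsOfPowers k s
                       × (∀ t → 1 ≤ t → t < s → ¬ AllSumsOfPowers k t)

module Submission where

open import Defs
open import Level using (Level)
open import Data.Nat as ℕ using (ℕ; zero; suc; z≤n; s≤s; NonZero)
open import Data.Nat.Properties as ℕ using (_!*_!≢0)
open import Data.Nat.Combinatorics using (_C_; nCk≡n!/k![n-k]!; k![n∸k]!∣n!; nCn≡1; nCk≡nC[n∸k])
open import Data.Nat.Divisibility using (_∣_; _∤_; divides; m∣m*n; ∣1⇒≡1; ∣⇒≤; m%n≡0⇒n∣m)
open import Data.Nat.DivMod using (m/n*n≡m; m≡m%n+[m/n]*n; m%n<n; m*n/n≡m)
open import Data.Nat.Primality using (Prime; euclidsLemma; prime⇒nonZero; prime⇒nonTrivial; prime[2])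
open import Data.Nat.Tactic.RingSolver using (solve-∀)
open import Data.Fin as Fin using (Fin; zero; suc; toℕ)
import Data.Fin.Properties as Fin
open import Data.Vec.Functional as Vector using (removeAt)
open import Data.Product using (Σ; ∃-syntax; _,_; proj₁; proj₂)
open import Data.Sum using (inj₁; inj₂)
open import Data.Empty using (⊥-elim)
open import Data.List using (List; []; _∷_; length; filter; tabulate; map; deduplicate)
import Data.List.Properties as List
open import Data.List.Relation.Unary.All as All using (All; []; _∷_)
import Data.List.Relation.Unary.All.Properties as All
open import Data.List.Relation.Unary.Any as Any using (here; there)
open import Data.List.Relation.Unary.AllPairs using ([]; _∷_)
import Data.List.Relation.Unary.Unique.Setoid as UniqueSetoid
import Data.List.Relation.Unary.Unique.Setoid.Properties as Unique
import Data.List.Relation.Unary.Unique.DecSetoid.Properties as Unique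
import Data.List.Membership.Setoid as Membership
import Data.List.Membership.Setoid.Properties as ∈
open import Function using (_∘_)
open import Function.Bundles using (Inverse; _↔_)
import Function.Construct.Composition as Compose
import Function.Construct.Symmetry as Symmetry
open import Relation.Nullary using (¬_; yes; no; Dec)
open import Relation.Nullary.Negation using (contradiction)
open import Relation.Unary using (Pred; Decidable)
open import Relation.Unary.Properties using (∁?)
open import Relation.Binary.Bundles using (DecSetoid)
open import Relation.Binary.PropositionalEquality as ≡ using (_≡_; _≢_)
open import Algebra.Bundles using (CommutativeSemiring; CommutativeMonoid; Semiring)
import Algebra.Properties.CommutativeMonoid.Sum as Sum

-- Let r = pᵃ = 2m + 1, k = (r + 1) / 2 = m + 1 and q = r², so that q = 1 + k·4m. By Fermat's
-- little theorem every k-th power y satisfies y^(1+4m) = y; conversely every such y is a k-th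
-- power, because the fibres of x ↦ xᵏ have at most k elements while X^(1+4m) - X has at most
-- 1 + 4m roots. The Frobenius φ x = x ^ r is an additive involution, so for z = y / 2 the
-- elements α = z + φ z and γ = z - φ z satisfy φ α = α, φ γ = - γ and α + γ = y. From
-- x ^ r = ± x one gets x ^ (2r - 1) = x, and 2r - 1 = 1 + 4m, so α and γ are k-th powers.
-- Finally, not every element is a k-th power, since X^(1+4m) - X has fewer than q roots.

module _ where
  open import Data.Nat using (_<_; _∸_; _*_; _!)

  p∤n! : ∀ {p n} → Prime p → n < p → p ∤ n !
  p∤n! {p} {zero} p-prime _ p∣1 =
    ℕ.<-irrefl (≡.sym (∣1⇒≡1 p∣1)) (ℕ.nonTrivial⇒n>1 p {{prime⇒nonTrivial p-prime}})
  p∤n! {p} {suc n} p-prime n<p p∣n! with euclidsLemma (suc n) (n !) p-prime p∣n!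
  ... | inj₁ p∣1+n = ℕ.<⇒≱ n<p (∣⇒≤ p∣1+n)
  ... | inj₂ p∣n! = p∤n! p-prime (ℕ.<-trans (ℕ.n<1+n n) n<p) p∣n!

  n∣n! : ∀ n → .{{NonZero n}} → n ∣ n !
  n∣n! (suc n) = m∣m*n (n !)

  p∣pCk : ∀ {p k} → Prime p → 0 < k → k < p → p ∣ p C k
  p∣pCk {p} {k} p-prime 0<k k<p
    with euclidsLemma (p C k) (k ! * (p ∸ k) !) p-prime p∣pCk*k!*[p-k]!
    where
    instance
      _ = k !* (p ∸ k) !≢0
    p! : p ! ≡ (p C k) * (k ! * (p ∸ k) !)
    p! = ≡.trans (≡.sym (m/n*n≡m (k![n∸k]!∣n! (ℕ.<⇒≤ k<p))))
                 (≡.cong (_* (k ! * (p ∸ k) !)) (≡.sym (nCk≡n!/k![n-k]! (ℕ.<⇒≤ k<p))))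
    p∣pCk*k!*[p-k]! : p ∣ (p C k) * (k ! * (p ∸ k) !)
    p∣pCk*k!*[p-k]! = ≡.subst (p ∣_) p! (n∣n! p {{prime⇒nonZero p-prime}})
  ... | inj₁ p∣pCk = p∣pCk
  ... | inj₂ p∣k!*[p-k]! with euclidsLemma (k !) ((p ∸ k) !) p-prime p∣k!*[p-k]!
  ...   | inj₁ p∣k! = ⊥-elim (p∤n! p-prime k<p p∣k!)
  ...   | inj₂ p∣[p-k]! = ⊥-elim (p∤n! p-prime (ℕ.∸-monoʳ-< 0<k (ℕ.<⇒≤ k<p)) p∣[p-k]!)

module FreshmansDream {c ℓ : Level} (S : CommutativeSemiring c ℓ) where
  open CommutativeSemiring S hiding (zero)
  open import Algebra.Definitions.RawSemiring rawSemiring using (_×_; _^_)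
  open import Algebra.Properties.Semiring.Mult semiring using (×-congʳ; ×-assocˡ; ×-assoc-*)
  open import Algebra.Properties.Semiring.Exp semiring using (^-congˡ; ^-assocʳ)
  open import Algebra.Properties.CommutativeSemiring.Binomial S using (theorem; binomialTerm; binomialExpansion)
  open import Algebra.Properties.Monoid.Sum +-monoid using (sum; sum-init-last; sum-cong-≋; sum-replicate-zero)
  open import Relation.Binary.Reasoning.Setoid setoid

  ×0#≈0# : ∀ n → n × 0# ≈ 0#
  ×0#≈0# zero = refl
  ×0#≈0# (suc n) = trans (+-identityˡ _) (×0#≈0# n)

  ∣⇒×≈0 : ∀ {p n} → p × 1# ≈ 0# → p ∣ n → ∀ x → n × x ≈ 0#
  ∣⇒×≈0 {p} p×1≈0 (divides m ≡.refl) x = begin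
    (m ℕ.* p) × x     ≈⟨ ×-assocˡ x m p ⟨
    m × (p × x)       ≈⟨ ×-congʳ m p×x≈0 ⟩
    m × 0#            ≈⟨ ×0#≈0# m ⟩
    0#                ∎
    where
    p×x≈0 : p × x ≈ 0#
    p×x≈0 = begin
      p × x             ≈⟨ ×-congʳ p (*-identityˡ x) ⟨
      p × (1# * x)      ≈⟨ ×-assoc-* p 1# x ⟨
      (p × 1#) * x      ≈⟨ *-congʳ p×1≈0 ⟩
      0# * x            ≈⟨ zeroˡ x ⟩
      0#                ∎

  binomialExpansion-ends : ∀ n x y →
                           (∀ k → 0 ℕ.< toℕ k → toℕ k ℕ.< suc n → binomialTerm x y (suc n) k ≈ 0#) →
                           binomialExpansion x y (suc n) ≈ x ^ suc n + y ^ suc n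
  binomialExpansion-ends n x y middle≈0 = begin
    T zero + sum (λ i → T (suc i))                                ≈⟨ +-cong first (sum-init-last (λ i → T (suc i))) ⟩
    y ^ suc n + (sum (λ i → T (suc (Fin.inject₁ i))) + T (suc (Fin.fromℕ n))) ≈⟨ +-congˡ (+-cong middle last) ⟩
    y ^ suc n + (0# + x ^ suc n)                                  ≈⟨ +-congˡ (+-identityˡ _) ⟩
    y ^ suc n + x ^ suc n                                         ≈⟨ +-comm _ _ ⟩
    x ^ suc n + y ^ suc n                                         ∎
    where
    T = binomialTerm x y (suc n)
    first : T zero ≈ y ^ suc n
    first rewrite nCk≡nC[n∸k] {0} {suc n} z≤n | nCn≡1 (suc n) = trans (+-identityʳ _) (*-identityˡ _)
    last : T (suc (Fin.fromℕ n)) ≈ x ^ suc n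
    last rewrite Fin.toℕ-fromℕ n | nCn≡1 (suc n) | ℕ.n∸n≡0 n = trans (+-identityʳ _) (*-identityʳ _)
    middle : sum (λ i → T (suc (Fin.inject₁ i))) ≈ 0#
    middle = trans (sum-cong-≋ {n} (λ i → middle≈0 (suc (Fin.inject₁ i)) (s≤s z≤n)
                     (s≤s (≡.subst (ℕ._< n) (≡.sym (Fin.toℕ-inject₁ i)) (Fin.toℕ<n i)))))
                   (sum-replicate-zero n)

  ^p-distrib-+ : ∀ {p} → Prime p → p × 1# ≈ 0# → ∀ x y → (x + y) ^ p ≈ x ^ p + y ^ p
  ^p-distrib-+ {suc n} p-prime p×1≈0 x y = begin
    (x + y) ^ suc n                 ≈⟨ theorem (suc n) x y ⟩
    binomialExpansion x y (suc n)   ≈⟨ binomialExpansion-ends n x y middle≈0 ⟩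
    x ^ suc n + y ^ suc n           ∎
    where
    middle≈0 : ∀ k → 0 ℕ.< toℕ k → toℕ k ℕ.< suc n → binomialTerm x y (suc n) k ≈ 0#
    middle≈0 k 0<k k<p = ∣⇒×≈0 p×1≈0 (p∣pCk p-prime 0<k k<p) _

  ^pᵉ-distrib-+ : ∀ {p} → Prime p → p × 1# ≈ 0# → ∀ e x y → (x + y) ^ (p ℕ.^ e) ≈ x ^ (p ℕ.^ e) + y ^ (p ℕ.^ e)
  ^pᵉ-distrib-+ p-prime p×1≈0 zero x y = trans (*-identityʳ _) (sym (+-cong (*-identityʳ x) (*-identityʳ y)))
  ^pᵉ-distrib-+ {p} p-prime p×1≈0 (suc e) x y = begin
    (x + y) ^ (p ℕ.* p ℕ.^ e)                 ≈⟨ ^-assocʳ (x + y) p (p ℕ.^ e) ⟨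
    ((x + y) ^ p) ^ (p ℕ.^ e)                 ≈⟨ ^-congˡ (p ℕ.^ e) (^p-distrib-+ p-prime p×1≈0 x y) ⟩
    (x ^ p + y ^ p) ^ (p ℕ.^ e)               ≈⟨ ^pᵉ-distrib-+ p-prime p×1≈0 e (x ^ p) (y ^ p) ⟩
    (x ^ p) ^ (p ℕ.^ e) + (y ^ p) ^ (p ℕ.^ e) ≈⟨ +-cong (^-assocʳ x p (p ℕ.^ e)) (^-assocʳ y p (p ℕ.^ e)) ⟩
    x ^ (p ℕ.* p ℕ.^ e) + y ^ (p ℕ.* p ℕ.^ e) ∎

module FieldProperties {c ℓ : Level} (K : Field c ℓ) where
  open Field K
  open import Data.Product using (_×_)
  open import Algebra.Definitions.RawSemiring (Semiring.rawSemiring semiring) using (_^_)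
  open import Algebra.Properties.Ring ring
    using (-‿distribʳ-*; x[y-z]≈xy-xz; x∙y⁻¹≈ε⇒x≈y; x≈y⇒x∙y⁻¹≈ε; //-rightDividesˡ; x+x≈x⇒x≈0; +-inverseʳ-unique; ⁻¹-anti-homo‿-)
  open import Relation.Binary.Reasoning.Setoid setoid
  open import Algebra.Solver.Ring.NaturalCoefficients.Default commutativeSemiring using (solve; _:=_; _:+_; _:*_; con)
  open UniqueSetoid setoid using (Unique)

  x*y≈0⇒y≈0 : ∀ {x y} → ¬ x ≈ 0# → x * y ≈ 0# → y ≈ 0#
  x*y≈0⇒y≈0 {x} {y} x≉0 xy≈0 with inverse x x≉0
  ... | x⁻¹ , x*x⁻¹≈1 = begin
    y                 ≈⟨ *-identityˡ y ⟨
    1# * y            ≈⟨ *-congʳ x*x⁻¹≈1 ⟨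
    (x * x⁻¹) * y     ≈⟨ solve 3 (λ x x⁻¹ y → (x :* x⁻¹) :* y := x⁻¹ :* (x :* y)) refl x x⁻¹ y ⟩
    x⁻¹ * (x * y)     ≈⟨ *-congˡ xy≈0 ⟩
    x⁻¹ * 0#          ≈⟨ zeroʳ x⁻¹ ⟩
    0#                ∎

  *-≉0 : ∀ {x y} → ¬ x ≈ 0# → ¬ y ≈ 0# → ¬ x * y ≈ 0#
  *-≉0 x≉0 y≉0 xy≈0 = y≉0 (x*y≈0⇒y≈0 x≉0 xy≈0)

  ^-≉0 : ∀ {x} → ¬ x ≈ 0# → ∀ n → ¬ x ^ n ≈ 0#
  ^-≉0 x≉0 zero 1≈0 = 0≉1 (sym 1≈0)
  ^-≉0 x≉0 (suc n) = *-≉0 x≉0 (^-≉0 x≉0 n)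

  *-cancelˡ-≉0 : ∀ {x y z} → ¬ x ≈ 0# → x * y ≈ x * z → y ≈ z
  *-cancelˡ-≉0 {x} {y} {z} x≉0 xy≈xz = x∙y⁻¹≈ε⇒x≈y y z (x*y≈0⇒y≈0 x≉0 (begin
    x * (y - z)         ≈⟨ distribˡ x y (- z) ⟩
    x * y + x * - z     ≈⟨ +-congˡ (-‿distribʳ-* x z) ⟨
    x * y - x * z       ≈⟨ x≈y⇒x∙y⁻¹≈ε xy≈xz ⟩
    0#                  ∎))

  -- Polynomials are coefficient lists, constant term first; divide a c₀ cs is synthetic
  -- division of c₀ ∷ cs by X - a, returning the quotient and the remainder.
  eval : List Carrier → Carrier → Carrier
  eval [] x = 0#
  eval (a ∷ p) x = a + x * eval p x

  divide : Carrier → Carrier → List Carrier → List Carrier × Carrier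
  divide a c₀ [] = [] , c₀
  divide a c₀ (c₁ ∷ cs) = let (q , r) = divide a c₁ cs in r ∷ q , c₀ + a * r

  eval-divide : ∀ a c₀ cs x →
                eval (c₀ ∷ cs) x ≈ (x - a) * eval (proj₁ (divide a c₀ cs)) x + proj₂ (divide a c₀ cs)
  eval-divide a c₀ [] x = solve 3 (λ c₀ x t → c₀ :+ x :* con 0 := t :* con 0 :+ c₀) refl c₀ x (x - a)
  eval-divide a c₀ (c₁ ∷ cs) x = begin
    c₀ + x * eval (c₁ ∷ cs) x         ≈⟨ +-congˡ (*-cong x≈t+a (eval-divide a c₁ cs x)) ⟩
    c₀ + (t + a) * (t * Q + r)        ≈⟨ regroup c₀ t a Q r ⟩
    t * (r + (t + a) * Q) + (c₀ + a * r) ≈⟨ +-congʳ (*-congˡ (+-congˡ (*-congʳ x≈t+a))) ⟨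
    t * (r + x * Q) + (c₀ + a * r)    ∎
    where
    t = x - a
    Q = eval (proj₁ (divide a c₁ cs)) x
    r = proj₂ (divide a c₁ cs)
    x≈t+a : x ≈ t + a
    x≈t+a = sym (//-rightDividesˡ a x)
    regroup : ∀ c₀ t a Q r → c₀ + (t + a) * (t * Q + r) ≈ t * (r + (t + a) * Q) + (c₀ + a * r)
    regroup = solve 5 (λ c₀ t a Q r → c₀ :+ (t :+ a) :* (t :* Q :+ r) := t :* (r :+ (t :+ a) :* Q) :+ (c₀ :+ a :* r)) refl

  length-divide : ∀ a c₀ cs → length (proj₁ (divide a c₀ cs)) ≡ length cs
  length-divide a c₀ [] = ≡.refl
  length-divide a c₀ (c₁ ∷ cs) = ≡.cong suc (length-divide a c₁ cs)

  divide-≈0 : ∀ a c₀ cs → All (_≈ 0#) (proj₁ (divide a c₀ cs)) → proj₂ (divide a c₀ cs) ≈ 0# →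
              All (_≈ 0#) (c₀ ∷ cs)
  divide-≈0 a c₀ [] [] c₀≈0 = c₀≈0 ∷ []
  divide-≈0 a c₀ (c₁ ∷ cs) (r≈0 ∷ q≈0) c₀+ar≈0 = c₀≈0 ∷ divide-≈0 a c₁ cs q≈0 r≈0
    where
    c₀≈0 : c₀ ≈ 0#
    c₀≈0 = begin
      c₀                                ≈⟨ +-identityʳ c₀ ⟨
      c₀ + 0#                           ≈⟨ +-congˡ (trans (*-congˡ r≈0) (zeroʳ a)) ⟨
      c₀ + a * proj₂ (divide a c₁ cs)   ≈⟨ c₀+ar≈0 ⟩
      0#                                ∎

  remainder≈eval : ∀ a c₀ cs → proj₂ (divide a c₀ cs) ≈ eval (c₀ ∷ cs) a
  remainder≈eval a c₀ cs = begin
    r                                ≈⟨ +-identityˡ r ⟨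
    0# + r                           ≈⟨ +-congʳ (zeroˡ _) ⟨
    0# * eval (proj₁ (divide a c₀ cs)) a + r  ≈⟨ +-congʳ (*-congʳ (x≈y⇒x∙y⁻¹≈ε refl)) ⟨
    (a - a) * eval (proj₁ (divide a c₀ cs)) a + r  ≈⟨ eval-divide a c₀ cs a ⟨
    eval (c₀ ∷ cs) a                 ∎
    where
    r = proj₂ (divide a c₀ cs)

  IsRoot : List Carrier → Carrier → Set ℓ
  IsRoot p x = eval p x ≈ 0#

  quotient-root : ∀ a c₀ cs {x} → ¬ a ≈ x → IsRoot (c₀ ∷ cs) a → IsRoot (c₀ ∷ cs) x →
                  IsRoot (proj₁ (divide a c₀ cs)) x
  quotient-root a c₀ cs {x} a≉x pa≈0 px≈0 = x*y≈0⇒y≈0 x-a≉0 (begin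
    (x - a) * Q                    ≈⟨ +-identityʳ _ ⟨
    (x - a) * Q + 0#               ≈⟨ +-congˡ (trans (remainder≈eval a c₀ cs) pa≈0) ⟨
    (x - a) * Q + proj₂ (divide a c₀ cs) ≈⟨ eval-divide a c₀ cs x ⟨
    eval (c₀ ∷ cs) x               ≈⟨ px≈0 ⟩
    0#                             ∎)
    where
    Q = eval (proj₁ (divide a c₀ cs)) x
    x-a≉0 : ¬ x - a ≈ 0#
    x-a≉0 x-a≈0 = a≉x (sym (x∙y⁻¹≈ε⇒x≈y x a x-a≈0))

  roots⇒≈0 : ∀ p {xs} → Unique xs → length p ℕ.≤ length xs → All (IsRoot p) xs → All (_≈ 0#) p
  roots⇒≈0 [] _ _ _ = []
  roots⇒≈0 (c₀ ∷ cs) {a ∷ as} (a≉as ∷ as!) (s≤s |cs|≤|as|) (pa≈0 ∷ pas≈0) =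
    divide-≈0 a c₀ cs
      (roots⇒≈0 (proj₁ (divide a c₀ cs)) as!
         (≡.subst (ℕ._≤ length as) (≡.sym (length-divide a c₀ cs)) |cs|≤|as|)
         (All.zipWith (λ (a≉x , px≈0) → quotient-root a c₀ cs a≉x pa≈0 px≈0) (a≉as , pas≈0)))
      (trans (remainder≈eval a c₀ cs) pa≈0)

  roots<length : ∀ p {xs} → ¬ All (_≈ 0#) p → Unique xs → All (IsRoot p) xs → length xs ℕ.< length p
  roots<length p {xs} p≉0 xs! roots with length p ℕ.≤? length xs
  ... | yes |p|≤|xs| = ⊥-elim (p≉0 (roots⇒≈0 p xs! |p|≤|xs| roots))
  ... | no |p|≰|xs| = ℕ.≰⇒> |p|≰|xs|

  monomial : ℕ → List Carrier
  monomial zero = 1# ∷ []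
  monomial (suc n) = 0# ∷ monomial n

  eval-monomial : ∀ n x → eval (monomial n) x ≈ x ^ n
  eval-monomial zero x = trans (+-congˡ (zeroʳ x)) (+-identityʳ 1#)
  eval-monomial (suc n) x = trans (+-identityˡ _) (*-congˡ (eval-monomial n x))

  length-monomial : ∀ n → length (monomial n) ≡ suc n
  length-monomial zero = ≡.refl
  length-monomial (suc n) = ≡.cong suc (length-monomial n)

  monomial≉0 : ∀ n → ¬ All (_≈ 0#) (monomial n)
  monomial≉0 zero (1≈0 ∷ []) = 0≉1 (sym 1≈0)
  monomial≉0 (suc n) (_ ∷ X^n≈0) = monomial≉0 n X^n≈0

  X^[1+_]-_ : ℕ → Carrier → List Carrier
  X^[1+ n ]- c = - c ∷ monomial n

  eval-X^[1+]- : ∀ n c x → eval (X^[1+ n ]- c) x ≈ x ^ suc n - c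
  eval-X^[1+]- n c x = trans (+-comm (- c) _) (+-congʳ (*-congˡ (eval-monomial n x)))

  roots-^≤ : ∀ n .{{_ : NonZero n}} c {xs} → Unique xs → All (λ x → x ^ n ≈ c) xs → length xs ℕ.≤ n
  roots-^≤ (suc n) c {xs} xs! roots = ≡.subst (length xs ℕ.≤_) (length-monomial n) (ℕ.≤-pred
    (roots<length (X^[1+ n ]- c) (monomial≉0 n ∘ All.tail) xs!
       (All.map (λ xⁿ≈c → trans (eval-X^[1+]- n c _) (x≈y⇒x∙y⁻¹≈ε xⁿ≈c)) roots)))

  roots-^suc≤ : ∀ n .{{_ : NonZero n}} {xs} → Unique xs → All (λ x → x ^ suc n ≈ x) xs → length xs ℕ.≤ suc n
  roots-^suc≤ (suc n) {xs} xs! roots = ≡.subst (length xs ℕ.≤_) (≡.cong suc (length-monomial n)) (ℕ.≤-pred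
    (roots<length (0# ∷ X^[1+ n ]- 1#) (monomial≉0 n ∘ All.tail ∘ All.tail) xs!
       (All.map root roots)))
    where
    root : ∀ {x} → x ^ suc (suc n) ≈ x → IsRoot (0# ∷ X^[1+ n ]- 1#) x
    root {x} x^[2+n]≈x = begin
      0# + x * eval (X^[1+ n ]- 1#) x   ≈⟨ +-identityˡ _ ⟩
      x * eval (X^[1+ n ]- 1#) x        ≈⟨ *-congˡ (eval-X^[1+]- n 1# x) ⟩
      x * (x ^ suc n - 1#)              ≈⟨ x[y-z]≈xy-xz x _ 1# ⟩
      x ^ suc (suc n) - x * 1#          ≈⟨ x≈y⇒x∙y⁻¹≈ε (trans x^[2+n]≈x (sym (*-identityʳ x))) ⟩
      0#                                ∎

  module _ (φ : Carrier → Carrier) (φ-cong : ∀ {x y} → x ≈ y → φ x ≈ φ y)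
           (φ-+ : ∀ x y → φ (x + y) ≈ φ x + φ y) where

    additive-0 : φ 0# ≈ 0#
    additive-0 = x+x≈x⇒x≈0 (φ 0#) (trans (sym (φ-+ 0# 0#)) (φ-cong (+-identityˡ 0#)))

    additive-‿ : ∀ x → φ (- x) ≈ - φ x
    additive-‿ x = +-inverseʳ-unique (φ x) (φ (- x))
      (trans (sym (φ-+ x (- x))) (trans (φ-cong (-‿inverseʳ x)) additive-0))

    involution-decomposition : (∀ x → φ (φ x) ≈ x) → ¬ 1# + 1# ≈ 0# →
                               ∀ y → Σ Carrier λ α → Σ Carrier λ γ → φ α ≈ α × φ γ ≈ - γ × α + γ ≈ y
    involution-decomposition φφ≈id 2≉0 y = z + φ z , z - φ z , φα≈α , φγ≈-γ , α+γ≈y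
      where
      ½ = proj₁ (inverse (1# + 1#) 2≉0)
      z = ½ * y
      φα≈α : φ (z + φ z) ≈ z + φ z
      φα≈α = trans (φ-+ z (φ z)) (trans (+-congˡ (φφ≈id z)) (+-comm (φ z) z))
      φγ≈-γ : φ (z - φ z) ≈ - (z - φ z)
      φγ≈-γ = begin
        φ (z - φ z)          ≈⟨ φ-+ z (- φ z) ⟩
        φ z + φ (- φ z)      ≈⟨ +-congˡ (trans (additive-‿ (φ z)) (-‿cong (φφ≈id z))) ⟩
        φ z - z              ≈⟨ ⁻¹-anti-homo‿- z (φ z) ⟨
        - (z - φ z)          ∎
      α+γ≈y : (z + φ z) + (z - φ z) ≈ y
      α+γ≈y = begin
        (z + φ z) + (z - φ z)          ≈⟨ regroup z (φ z) (- φ z) ⟩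
        (1# + 1#) * z + (φ z - φ z)    ≈⟨ +-cong (sym (*-assoc (1# + 1#) ½ y)) (-‿inverseʳ (φ z)) ⟩
        ((1# + 1#) * ½) * y + 0#       ≈⟨ +-identityʳ _ ⟩
        ((1# + 1#) * ½) * y            ≈⟨ *-congʳ (proj₂ (inverse (1# + 1#) 2≉0)) ⟩
        1# * y                         ≈⟨ *-identityˡ y ⟩
        y                              ∎
        where
        regroup : ∀ z w w′ → (z + w) + (z + w′) ≈ (1# + 1#) * z + (w + w′)
        regroup = solve 3 (λ z w w′ → (z :+ w) :+ (z :+ w′) := (con 1 :+ con 1) :* z :+ (w :+ w′)) refl

length-filter+length-filter-∁ : ∀ {a p} {A : Set a} {P : Pred A p} (P? : Decidable P) xs →
                                length (filter P? xs) ℕ.+ length (filter (∁? P?) xs) ≡ length xs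
length-filter+length-filter-∁ P? [] = ≡.refl
length-filter+length-filter-∁ P? (x ∷ xs) with P? x
... | yes _ = ≡.cong suc (length-filter+length-filter-∁ P? xs)
... | no _ = ≡.trans (ℕ.+-suc _ _) (≡.cong suc (length-filter+length-filter-∁ P? xs))

module _ {a ℓ : Level} (S : DecSetoid a ℓ) where
  open DecSetoid S
  open UniqueSetoid setoid using (Unique)
  open Membership setoid using (_∈_)

  length≤fibre*image : (f : Carrier → Carrier) (e : ℕ) →
                       (∀ y {zs} → Unique zs → All (λ z → f z ≈ y) zs → length zs ℕ.≤ e) →
                       ∀ I {xs} → Unique xs → All (λ x → f x ∈ I) xs → length xs ℕ.≤ e ℕ.* length I
  length≤fibre*image f e fibre≤e [] {[]} _ _ = z≤n
  length≤fibre*image f e fibre≤e [] {x ∷ xs} _ (() ∷ _)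
  length≤fibre*image f e fibre≤e (y ∷ I) {xs} xs! fxs∈y∷I = begin
    length xs                                     ≡⟨ length-filter+length-filter-∁ (λ z → f z ≟ y) xs ⟨
    length (filter P? xs) ℕ.+ length (filter (∁? P?) xs) ≤⟨ ℕ.+-mono-≤ fibre rest ⟩
    e ℕ.+ e ℕ.* length I                          ≡⟨ ℕ.*-suc e (length I) ⟨
    e ℕ.* length (y ∷ I)                          ∎
    where
    open ℕ.≤-Reasoning
    P? : Decidable (λ z → f z ≈ y)
    P? z = f z ≟ y
    fibre : length (filter P? xs) ℕ.≤ e
    fibre = fibre≤e y (Unique.filter⁺ setoid P? xs!) (All.all-filter P? xs)
    avoids-y : ∀ {zs} → All (λ x → f x ∈ y ∷ I) zs → All (λ x → f x ∈ I) (filter (∁? P?) zs)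
    avoids-y [] = []
    avoids-y {z ∷ zs} (fz∈y∷I ∷ rest) with P? z | fz∈y∷I
    ... | yes _ | _ = avoids-y rest
    ... | no fz≉y | here fz≈y = ⊥-elim (fz≉y fz≈y)
    ... | no _ | there fz∈I = fz∈I ∷ avoids-y rest
    rest : length (filter (∁? P?) xs) ℕ.≤ e ℕ.* length I
    rest = length≤fibre*image f e fibre≤e I (Unique.filter⁺ setoid (∁? P?) xs!) (avoids-y fxs∈y∷I)

module _ {c ℓ : Level} (M : CommutativeMonoid c ℓ) {q : ℕ}
         (card : Inverse (CommutativeMonoid.setoid M) (≡.setoid (Fin q))) where
  open CommutativeMonoid M
  open Sum M using (sum; sum-permute; sum-cong-≋)
  open Inverse card using (to; from)

  sum-reindex : ∀ (σ : Inverse setoid setoid) {g : Carrier → Carrier} → (∀ {x y} → x ≈ y → g x ≈ g y) →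
                sum (g ∘ from) ≈ sum (g ∘ Inverse.to σ ∘ from)
  sum-reindex σ {g} g-cong =
    trans (sum-permute (g ∘ from) π)
          (sum-cong-≋ {q} (λ i → g-cong (Inverse.inverseʳ card {Inverse.to σ (from i)} ≡.refl)))
    where
    π : Fin q ↔ Fin q
    π = Compose.inverse (Compose.inverse (Symmetry.inverse card) σ) card

module FiniteFieldProperties {c ℓ : Level} {q : ℕ} (F : FiniteField c ℓ q) where
  open FiniteField F hiding (zero)
  open FieldProperties fld public
  open import Algebra.Definitions.RawSemiring (Semiring.rawSemiring semiring) using (_^_; _×_)
  open import Algebra.Properties.Semiring.Exp semiring using (^-congˡ; ^-homo-*; ^-assocʳ)
  open import Algebra.Properties.Semiring.Mult semiring using (×1-homo-*)
  open import Algebra.Properties.Ring ring using (+-cancelˡ; //-rightDividesˡ; //-rightDividesʳ)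
  open import Relation.Binary.Reasoning.Setoid setoid
  open import Function.Properties.Inverse using (Inverse⇒Injection)
  open import Function.Bundles using (Injection)
  open import Relation.Nullary.Decidable using (map′)
  open Inverse card using (to; from)
  open UniqueSetoid setoid using (Unique)
  open Membership setoid using (_∈_)
  module ∑ = Sum +-commutativeMonoid
  module ∏ = Sum *-commutativeMonoid

  infix 4 _≟_
  _≟_ : (x y : Carrier) → Dec (x ≈ y)
  x ≟ y = map′ (Injection.injective (Inverse⇒Injection card)) (Inverse.to-cong card) (to x Fin.≟ to y)

  decSetoid : DecSetoid c ℓ
  decSetoid = record { isDecEquivalence = record { isEquivalence = isEquivalence ; _≟_ = _≟_ } }

  elements : List Carrier
  elements = tabulate from

  elements-unique : Unique elements
  elements-unique = Unique.tabulate⁺ setoid (Injection.injective (Inverse⇒Injection (Symmetry.inverse card)))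

  length-elements : length elements ≡ q
  length-elements = List.length-tabulate from

  ∈-elements : ∀ x → x ∈ elements
  ∈-elements x = ∈.∈-resp-≈ setoid (Inverse.inverseʳ card ≡.refl) (∈.∈-tabulate⁺ setoid (to x))

  translation : Carrier → Inverse setoid setoid
  translation a = record
    { to = _+ a ; from = _- a ; to-cong = +-congʳ ; from-cong = +-congʳ
    ; inverse = (λ y≈x-a → trans (+-congʳ y≈x-a) (//-rightDividesˡ a _))
              , (λ y≈x+a → trans (+-congʳ y≈x+a) (//-rightDividesʳ a _)) }

  -- ∑ x is invariant under the translation x ↦ x + 1, which adds q × 1# to it.
  card×1≈0 : q × 1# ≈ 0#
  card×1≈0 = +-cancelˡ S _ _ (begin
    S + q × 1#                    ≈⟨ +-congˡ (∑.sum-replicate q) ⟨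
    S + ∑.sum {q} (λ _ → 1#)      ≈⟨ ∑.∑-distrib-+ from (λ _ → 1#) ⟨
    ∑.sum (λ i → from i + 1#)     ≈⟨ sum-reindex +-commutativeMonoid card (translation 1#) (λ x≈y → x≈y) ⟨
    S                             ≈⟨ +-identityʳ S ⟨
    S + 0#                        ∎)
    where
    S = ∑.sum from

  odd-card⇒1+1≉0 : ∀ t → q ≡ suc (t ℕ.* 2) → ¬ 1# + 1# ≈ 0#
  odd-card⇒1+1≉0 t q≡1+2t 1+1≈0 = 0≉1 (begin
    0#                           ≈⟨ card×1≈0 ⟨
    q × 1#                       ≡⟨ ≡.cong (_× 1#) q≡1+2t ⟩
    1# + (t ℕ.* 2) × 1#          ≈⟨ +-congˡ (×1-homo-* t 2) ⟩
    1# + (t × 1#) * (1# + (1# + 0#)) ≈⟨ +-congˡ (*-congˡ (trans (+-congˡ (+-identityʳ 1#)) 1+1≈0)) ⟩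
    1# + (t × 1#) * 0#           ≈⟨ +-congˡ (zeroʳ _) ⟩
    1# + 0#                      ≈⟨ +-identityʳ 1# ⟩
    1#                           ∎)

  ×1-^ : ∀ p e → (p ℕ.^ e) × 1# ≈ (p × 1#) ^ e
  ×1-^ p zero = +-identityʳ 1#
  ×1-^ p (suc e) = trans (×1-homo-* p (p ℕ.^ e)) (*-congˡ (×1-^ p e))

  card≡pᵉ⇒p×1≈0 : ∀ {p e} → q ≡ p ℕ.^ e → p × 1# ≈ 0#
  card≡pᵉ⇒p×1≈0 {p} {e} q≡pᵉ with p × 1# ≟ 0#
  ... | yes p×1≈0 = p×1≈0
  ... | no p×1≉0 = ⊥-elim (^-≉0 p×1≉0 e (begin
    (p × 1#) ^ e       ≈⟨ ×1-^ p e ⟨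
    (p ℕ.^ e) × 1#     ≡⟨ ≡.cong (_× 1#) q≡pᵉ ⟨
    q × 1#             ≈⟨ card×1≈0 ⟩
    0#                 ∎))

  ^pᵃ-distrib-+ : ∀ {p e a r} → Prime p → q ≡ p ℕ.^ e → p ℕ.^ a ≡ r → ∀ x y → (x + y) ^ r ≈ x ^ r + y ^ r
  ^pᵃ-distrib-+ {p} {e} {a} p-prime q≡pᵉ ≡.refl =
    FreshmansDream.^pᵉ-distrib-+ commutativeSemiring p-prime (card≡pᵉ⇒p×1≈0 {p} {e} q≡pᵉ) a

  scaling : ∀ a → ¬ a ≈ 0# → Inverse setoid setoid
  scaling a a≉0 = record
    { to = a *_ ; from = a⁻¹ *_ ; to-cong = *-congˡ ; from-cong = *-congˡ
    ; inverse = (λ y≈a⁻¹x → trans (*-congˡ y≈a⁻¹x) (cancel a a⁻¹ (proj₂ (inverse a a≉0))))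
              , (λ y≈ax → trans (*-congˡ y≈ax) (cancel a⁻¹ a (trans (*-comm a⁻¹ a) (proj₂ (inverse a a≉0))))) }
    where
    a⁻¹ = proj₁ (inverse a a≉0)
    cancel : ∀ u v {x} → u * v ≈ 1# → u * (v * x) ≈ x
    cancel u v {x} uv≈1 = trans (sym (*-assoc u v x)) (trans (*-congʳ uv≈1) (*-identityˡ x))

  nonzeroPart : Carrier → Carrier
  nonzeroPart x with x ≟ 0#
  ... | yes _ = 1#
  ... | no _ = x

  nonzeroPart-cong : ∀ {x y} → x ≈ y → nonzeroPart x ≈ nonzeroPart y
  nonzeroPart-cong {x} {y} x≈y with x ≟ 0# | y ≟ 0#
  ... | yes _ | yes _ = refl
  ... | yes x≈0 | no y≉0 = ⊥-elim (y≉0 (trans (sym x≈y) x≈0))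
  ... | no x≉0 | yes y≈0 = ⊥-elim (x≉0 (trans x≈y y≈0))
  ... | no _ | no _ = x≈y

  nonzeroPart≉0 : ∀ x → ¬ nonzeroPart x ≈ 0#
  nonzeroPart≉0 x with x ≟ 0#
  ... | yes _ = λ 1≈0 → 0≉1 (sym 1≈0)
  ... | no x≉0 = x≉0

  scale : Carrier → Carrier → Carrier
  scale a x with x ≟ 0#
  ... | yes _ = 1#
  ... | no _ = a

  nonzeroPart-* : ∀ {a} → ¬ a ≈ 0# → ∀ x → nonzeroPart (a * x) ≈ scale a x * nonzeroPart x
  nonzeroPart-* {a} a≉0 x with x ≟ 0# | a * x ≟ 0#
  ... | yes _ | yes _ = sym (*-identityˡ 1#)
  ... | yes x≈0 | no ax≉0 = ⊥-elim (ax≉0 (trans (*-congˡ x≈0) (zeroʳ a)))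
  ... | no x≉0 | yes ax≈0 = ⊥-elim (*-≉0 a≉0 x≉0 ax≈0)
  ... | no _ | no _ = refl

  ∏-≉0 : ∀ {n} (t : Fin n → Carrier) → (∀ i → ¬ t i ≈ 0#) → ¬ ∏.sum t ≈ 0#
  ∏-≉0 {zero} t _ 1≈0 = 0≉1 (sym 1≈0)
  ∏-≉0 {suc n} t t≉0 = *-≉0 (t≉0 zero) (∏-≉0 (t ∘ suc) (t≉0 ∘ suc))

  ∏-all-but-one : ∀ {n} (t : Fin n → Carrier) i a → t i ≈ 1# → (∀ j → j ≢ i → t j ≈ a) →
                  ∏.sum t ≈ a ^ ℕ.pred n
  ∏-all-but-one {suc n} t i a tᵢ≈1 tⱼ≈a = begin
    ∏.sum t                             ≈⟨ ∏.sum-remove {i = i} t ⟩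
    t i * ∏.sum (removeAt t i)          ≈⟨ *-cong tᵢ≈1 (∏.sum-cong-≋ (λ j → tⱼ≈a _ (Fin.punchInᵢ≢i i j))) ⟩
    1# * ∏.sum {n} (λ _ → a)            ≈⟨ *-identityˡ _ ⟩
    ∏.sum {n} (λ _ → a)                 ≈⟨ ∏.sum-replicate n ⟩
    a ^ n                               ∎

  -- The product of all nonzero elements, taken over the whole field with 0 replaced by 1, is
  -- invariant under x ↦ a * x, which multiplies it by a ^ (q - 1).
  ^[q-1]≈1 : ∀ {a} → ¬ a ≈ 0# → a ^ ℕ.pred q ≈ 1#
  ^[q-1]≈1 {a} a≉0 = sym (*-cancelˡ-≉0 P≉0 (begin
    P * 1#                                  ≈⟨ *-identityʳ P ⟩
    P                                       ≈⟨ sum-reindex *-commutativeMonoid card (scaling a a≉0) nonzeroPart-cong ⟩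
    ∏.sum (λ i → nonzeroPart (a * from i))  ≈⟨ ∏.sum-cong-≋ (nonzeroPart-* a≉0 ∘ from) ⟩
    ∏.sum (λ i → scale a (from i) * nonzeroPart (from i)) ≈⟨ ∏.∑-distrib-+ (scale a ∘ from) (nonzeroPart ∘ from) ⟩
    ∏.sum (scale a ∘ from) * P              ≈⟨ *-congʳ (∏-all-but-one _ (to 0#) a scale-at-0 scale-elsewhere) ⟩
    a ^ ℕ.pred q * P                        ≈⟨ *-comm _ P ⟩
    P * a ^ ℕ.pred q                        ∎))
    where
    P = ∏.sum (nonzeroPart ∘ from)
    P≉0 : ¬ P ≈ 0#
    P≉0 = ∏-≉0 (nonzeroPart ∘ from) (nonzeroPart≉0 ∘ from)
    scale-at-0 : scale a (from (to 0#)) ≈ 1#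
    scale-at-0 with from (to 0#) ≟ 0#
    ... | yes _ = refl
    ... | no from-to-0≉0 = ⊥-elim (from-to-0≉0 (Inverse.inverseʳ card ≡.refl))
    scale-elsewhere : ∀ j → j ≢ to 0# → scale a (from j) ≈ a
    scale-elsewhere j j≢to0 with from j ≟ 0#
    ... | yes from-j≈0 = ⊥-elim (j≢to0 (≡.sym (Inverse.inverseˡ card (sym from-j≈0))))
    ... | no _ = refl

  instance
    card≢0 : NonZero q
    card≢0 = Fin.nonZeroIndex (to 0#)

  ^q≈id : ∀ x → x ^ q ≈ x
  ^q≈id x = begin
    x ^ q                ≡⟨ ≡.cong (x ^_) (ℕ.suc-pred q) ⟨
    x * x ^ ℕ.pred q     ≈⟨ x*x^[q-1]≈x ⟩
    x                    ∎
    where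
    x*x^[q-1]≈x : x * x ^ ℕ.pred q ≈ x
    x*x^[q-1]≈x with x ≟ 0#
    ... | yes x≈0 = trans (*-congʳ x≈0) (trans (zeroˡ _) (sym x≈0))
    ... | no x≉0 = trans (*-congˡ (^[q-1]≈1 x≉0)) (*-identityʳ x)

  IsPower : ℕ → Carrier → Set (c Level.⊔ ℓ)
  IsPower k y = Σ Carrier λ x → x ^ k ≈ y

  power⇒fixed : ∀ k n .{{_ : NonZero k}} → q ≡ suc (k ℕ.* n) → ∀ {y} → IsPower k y → y ^ suc n ≈ y
  power⇒fixed (suc k) n q≡1+kn {y} (x , xᵏ≈y) = begin
    y ^ suc n                        ≈⟨ ^-congˡ (suc n) xᵏ≈y ⟨
    (x ^ suc k) ^ suc n              ≈⟨ ^-assocʳ x (suc k) (suc n) ⟩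
    x ^ (suc k ℕ.* suc n)            ≡⟨ ≡.cong (x ^_) exponent ⟩
    x ^ (k ℕ.+ q)                    ≈⟨ ^-homo-* x k q ⟩
    x ^ k * x ^ q                    ≈⟨ *-congˡ (^q≈id x) ⟩
    x ^ k * x                        ≈⟨ *-comm _ x ⟩
    x ^ suc k                        ≈⟨ xᵏ≈y ⟩
    y                                ∎
    where
    exponent : suc k ℕ.* suc n ≡ k ℕ.+ q
    exponent = ≡.trans (ℕ.*-suc (suc k) n) (≡.trans (≡.sym (ℕ.+-suc k _)) (≡.cong (k ℕ.+_) (≡.sym q≡1+kn)))

  powers : ℕ → List Carrier
  powers k = deduplicate _≟_ (map (_^ k) elements)

  powers-unique : ∀ k → Unique (powers k)
  powers-unique k = Unique.deduplicate-! decSetoid (map (_^ k) elements)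

  ∈-powers⁺ : ∀ k x → x ^ k ∈ powers k
  ∈-powers⁺ k x = ∈.∈-deduplicate⁺ setoid _≟_ (λ z≈y x≈y → trans x≈y (sym z≈y))
                    (∈.∈-map⁺ setoid setoid (^-congˡ k) (∈-elements x))

  ∈-powers⁻ : ∀ k {y} → y ∈ powers k → IsPower k y
  ∈-powers⁻ k y∈ with ∈.∈-map⁻ setoid setoid (∈.∈-deduplicate⁻ setoid _≟_ (map (_^ k) elements) y∈)
  ... | x , _ , y≈xᵏ = x , sym y≈xᵏ

  -- If y is not a k-th power then y ∷ powers k are distinct roots of X^(1+n) - X, so there are
  -- at most n k-th powers; as the fibres of x ↦ xᵏ have at most k elements, q ≤ k * n.
  fixed⇒power : ∀ k n .{{_ : NonZero k}} .{{_ : NonZero n}} → q ≡ suc (k ℕ.* n) →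
                ∀ {y} → y ^ suc n ≈ y → IsPower k y
  fixed⇒power k n q≡1+kn {y} y^[1+n]≈y with Any.any? (y ≟_) (powers k)
  ... | yes y∈powers = ∈-powers⁻ k y∈powers
  ... | no y∉powers =
    ⊥-elim (ℕ.<⇒≱ kn<q (ℕ.≤-trans q≤k*|powers| (ℕ.*-monoʳ-≤ k (ℕ.≤-pred |y∷powers|≤1+n))))
    where
    kn<q : k ℕ.* n ℕ.< q
    kn<q = ≡.subst (k ℕ.* n ℕ.<_) (≡.sym q≡1+kn) (ℕ.n<1+n _)
    |y∷powers|≤1+n : suc (length (powers k)) ℕ.≤ suc n
    |y∷powers|≤1+n = roots-^suc≤ n (All.¬Any⇒All¬ (powers k) y∉powers ∷ powers-unique k)
      (y^[1+n]≈y ∷ All.tabulateₛ setoid (power⇒fixed k n q≡1+kn ∘ ∈-powers⁻ k))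
    q≤k*|powers| : q ℕ.≤ k ℕ.* length (powers k)
    q≤k*|powers| = ≡.subst (ℕ._≤ k ℕ.* length (powers k)) length-elements
      (length≤fibre*image decSetoid (_^ k) k (λ y → roots-^≤ k y) (powers k) elements-unique
        (All.universal (∈-powers⁺ k) elements))

  all-fixed⇒card≤ : ∀ n .{{_ : NonZero n}} → (∀ y → y ^ suc n ≈ y) → q ℕ.≤ suc n
  all-fixed⇒card≤ n all-fixed =
    ≡.subst (ℕ._≤ suc n) length-elements (roots-^suc≤ n elements-unique (All.universal all-fixed elements))

module _ {c ℓ : Level} {q : ℕ} (F : FiniteField c ℓ q) where
  open FiniteField F hiding (zero)
  open FiniteFieldProperties F
  open import Algebra.Definitions.RawSemiring (Semiring.rawSemiring semiring) using (_^_; sum)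
  open import Algebra.Properties.Semiring.Exp semiring using (^-congˡ; ^-congʳ; ^-homo-*; ^-assocʳ)
  open import Algebra.Properties.Ring ring using (-1*x≈-x; -‿involutive)
  open import Relation.Binary.Reasoning.Setoid setoid

  module _ (m : ℕ) .{{_ : NonZero m}} where

    private
      r k n : ℕ
      r = suc (m ℕ.* 2)
      k = suc m
      n = m ℕ.* 4

    ^r≈sx⇒fixed : ∀ {s x} → x ^ r ≈ s * x → s * s ≈ 1# → x ^ suc n ≈ x
    ^r≈sx⇒fixed {s} {x} xʳ≈sx ss≈1 = begin
      x ^ suc n                 ≡⟨ ≡.cong (x ^_) (exponent m) ⟩
      x ^ (r ℕ.+ m ℕ.* 2)       ≈⟨ ^-homo-* x r (m ℕ.* 2) ⟩
      x ^ r * x ^ (m ℕ.* 2)     ≈⟨ *-congʳ xʳ≈sx ⟩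
      (s * x) * x ^ (m ℕ.* 2)   ≈⟨ *-assoc s x _ ⟩
      s * x ^ r                 ≈⟨ *-congˡ xʳ≈sx ⟩
      s * (s * x)               ≈⟨ *-assoc s s x ⟨
      (s * s) * x               ≈⟨ *-congʳ ss≈1 ⟩
      1# * x                    ≈⟨ *-identityˡ x ⟩
      x                         ∎
      where
      exponent : ∀ m → suc (m ℕ.* 4) ≡ suc (m ℕ.* 2) ℕ.+ m ℕ.* 2
      exponent = solve-∀

    module _ (q≡r² : q ≡ r ℕ.* r) (^r-distrib-+ : ∀ x y → (x + y) ^ r ≈ x ^ r + y ^ r) where

      private
        instance
          n≢0 : NonZero n
          n≢0 = ℕ.m*n≢0 m 4

      q≡1+kn : q ≡ suc (k ℕ.* n)
      q≡1+kn = ≡.trans q≡r² (r²≡1+kn m)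
        where
        r²≡1+kn : ∀ m → suc (m ℕ.* 2) ℕ.* suc (m ℕ.* 2) ≡ suc (suc m ℕ.* (m ℕ.* 4))
        r²≡1+kn = solve-∀

      ^r-involutive : ∀ x → (x ^ r) ^ r ≈ x
      ^r-involutive x = trans (^-assocʳ x r r) (trans (^-congʳ x (≡.sym q≡r²)) (^q≈id x))

      1+1≉0 : ¬ 1# + 1# ≈ 0#
      1+1≉0 = odd-card⇒1+1≉0 (k ℕ.* (m ℕ.* 2)) (≡.trans q≡1+kn (≡.cong suc (kn≡[k*2m]*2 m)))
        where
        kn≡[k*2m]*2 : ∀ m → suc m ℕ.* (m ℕ.* 4) ≡ suc m ℕ.* (m ℕ.* 2) ℕ.* 2
        kn≡[k*2m]*2 = solve-∀

      ^r≈sx⇒power : ∀ {s x} → x ^ r ≈ s * x → s * s ≈ 1# → IsPower k x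
      ^r≈sx⇒power xʳ≈sx ss≈1 = fixed⇒power k n q≡1+kn (^r≈sx⇒fixed xʳ≈sx ss≈1)

      sumOfTwo : ∀ {α γ y} → IsPower k α → IsPower k γ → α + γ ≈ y →
                 Σ (Fin 2 → Carrier) λ x → sum (λ i → x i ^ k) ≈ y
      sumOfTwo (x₁ , x₁ᵏ≈α) (x₂ , x₂ᵏ≈γ) α+γ≈y =
        x₁ Vector.∷ x₂ Vector.∷ Vector.[] , trans (+-cong x₁ᵏ≈α (trans (+-identityʳ _) x₂ᵏ≈γ)) α+γ≈y

      sumsOfTwoPowers : AllSumsOfPowers F k 2
      sumsOfTwoPowers y =
        let α , γ , αʳ≈α , γʳ≈-γ , α+γ≈y =
              involution-decomposition (_^ r) (^-congˡ r) ^r-distrib-+ ^r-involutive 1+1≉0 y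
        in sumOfTwo
          (^r≈sx⇒power (trans αʳ≈α (sym (*-identityˡ α))) (*-identityˡ 1#))
          (^r≈sx⇒power (trans γʳ≈-γ (sym (-1*x≈-x γ))) (trans (-1*x≈-x (- 1#)) (-‿involutive 1#)))
          α+γ≈y

      notSumsOfOnePower : ¬ AllSumsOfPowers F k 1
      notSumsOfOnePower everyPower =
        ℕ.<⇒≱ n<kn (ℕ.≤-pred (≡.subst (ℕ._≤ suc n) q≡1+kn (all-fixed⇒card≤ n all-fixed)))
        where
        all-fixed : ∀ y → y ^ suc n ≈ y
        all-fixed y = power⇒fixed k n q≡1+kn
          (proj₁ (everyPower y) zero , trans (sym (+-identityʳ _)) (proj₂ (everyPower y)))
        n<kn : n ℕ.< k ℕ.* n
        n<kn = ℕ.m<m+n n (ℕ.>-nonZero⁻¹ (m ℕ.* n) {{ℕ.m*n≢0 m n}})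

      waringNumber≡2 : IsWaringNumber F k 2
      waringNumber≡2 = s≤s z≤n , sumsOfTwoPowers , λ where
        (suc zero) _ _ → notSumsOfOnePower
        (suc (suc _)) _ (s≤s (s≤s ()))

open import Data.Nat using (ℕ; _+_; _*_; _^_; _≤_; _/_)
open import Data.Nat.Primality using (Prime)
open import Data.Nat.Divisibility using (_∤_)
open import Data.Product using (_×_)

prime∤⇒∤^ : ∀ {d p} → Prime d → d ∤ p → ∀ a → d ∤ p ^ a
prime∤⇒∤^ {d} d-prime d∤p zero d∣1 =
  ℕ.<-irrefl (≡.sym (∣1⇒≡1 d∣1)) (ℕ.nonTrivial⇒n>1 d {{prime⇒nonTrivial d-prime}})
prime∤⇒∤^ {d} {p} d-prime d∤p (suc a) d∣pᵃ⁺¹ with euclidsLemma p (p ^ a) d-prime d∣pᵃ⁺¹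
... | inj₁ d∣p = d∤p d∣p
... | inj₂ d∣pᵃ = prime∤⇒∤^ d-prime d∤p a d∣pᵃ

2∤⇒≡1+[/2]*2 : ∀ {n} → 2 ∤ n → n ≡ suc (n / 2 * 2)
2∤⇒≡1+[/2]*2 {n} 2∤n = ≡.trans (m≡m%n+[m/n]*n n 2) (≡.cong (_+ n / 2 * 2) n%2≡1)
  where
  n%2≡1 : n ℕ.% 2 ≡ 1
  n%2≡1 with n ℕ.% 2 in eq | m%n<n n 2
  ... | 0 | _ = contradiction (m%n≡0⇒n∣m n 2 eq) 2∤n
  ... | 1 | _ = ≡.refl
  ... | suc (suc _) | ℕ.s≤s (ℕ.s≤s ())

odd-prime-power : ∀ {p a} → Prime p → 2 ∤ p → 1 ≤ a → ∃[ m ] NonZero m × p ^ a ≡ suc (m * 2)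
odd-prime-power {p} {a} p-prime 2∤p 1≤a = p ^ a / 2 , ℕ.≢-nonZero m≢0 , pᵃ≡1+2m
  where
  pᵃ≡1+2m : p ^ a ≡ suc (p ^ a / 2 * 2)
  pᵃ≡1+2m = 2∤⇒≡1+[/2]*2 (prime∤⇒∤^ prime[2] 2∤p a)
  m≢0 : p ^ a / 2 ≢ 0
  m≢0 m≡0 with ℕ.m^n≡1⇒n≡0∨m≡1 p a (≡.trans pᵃ≡1+2m (≡.cong (λ m → suc (m * 2)) m≡0))
  ... | inj₁ a≡0 = ℕ.<⇒≢ 1≤a (≡.sym a≡0)
  ... | inj₂ p≡1 = ℕ.<⇒≢ (ℕ.nonTrivial⇒n>1 p {{prime⇒nonTrivial p-prime}}) (≡.sym p≡1)

corollary6p2 : ∀ {c ℓ : Level} (p a : ℕ) → Prime p → 2 ∤ p → 1 ≤ a →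
    (F : FiniteField c ℓ (p ^ (2 * a))) → IsWaringNumber F ((p ^ a + 1) / 2) 2
corollary6p2 p a p-prime 2∤p 1≤a F with m , m≢0 , pᵃ≡1+2m ← odd-prime-power p-prime 2∤p 1≤a =
  ≡.subst (λ k → IsWaringNumber F k 2) (≡.sym k≡1+m)
    (waringNumber≡2 F m {{m≢0}} q≡r² (FiniteFieldProperties.^pᵃ-distrib-+ F {p} {2 * a} {a} p-prime ≡.refl pᵃ≡1+2m))
  where
  k≡1+m : (p ^ a + 1) / 2 ≡ suc m
  k≡1+m = ≡.trans (≡.cong (λ r → (r + 1) / 2) pᵃ≡1+2m)
                  (≡.trans (≡.cong (_/ 2) (1+2m+1≡[1+m]*2 m)) (m*n/n≡m (suc m) 2))
    where
    1+2m+1≡[1+m]*2 : ∀ m → suc (m * 2) + 1 ≡ suc m * 2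
    1+2m+1≡[1+m]*2 = solve-∀
  q≡r² : p ^ (2 * a) ≡ suc (m * 2) * suc (m * 2)
  q≡r² = ≡.trans (≡.trans (ℕ.^-distribˡ-+-* p a (a + 0)) (≡.cong (λ e → p ^ a * p ^ e) (ℕ.+-identityʳ a)))
                 (≡.cong₂ _*_ pᵃ≡1+2m pᵃ≡1+2m)
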